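{- Let $\mu$ be the Möbius function of the locally finite poset $(\mathcal{P}_m,\le_m)$, and let $C,D\in\mathcal{P}_m$ with $D\le_m C$. Then $\mu(D,C)=(-1)^{|S_C(D)|}$ if $D\in\mathbb{B}_C$, and $\mu(D,C)=0$ if $D\notin\mathbb{B}_C$.
   Context: $\mathcal{P}_m$ is the set of nonincreasing integer words $C=C_1\cdots C_m$; $D\le_m C$ iff $D_i\le C_i$ for all $i$ and $D_i>D_{i+1}$ whenever $C_i>C_{i+1}$. Write $C=M_1^{m_1}M_2^{m_2}\cdots M_t^{m_t}$ with $m_i>0$ and $M_1>\cdots>M_t$ (grouping equal letters). For $i\in\{1,\dots,t\}$, set $x_0=M_i$ and let $B_i$ be the set of words $x_1\cdots x_{m_i}$ of integers with $x_{j+1}\in\{x_j,x_j-1\}$ for $0\le j\le m_i-1$ and $x_{m_i}>M_{i+1}$ (vacuous when $i=t$). $\mathbb{B}_C$ is the set of concatenations $X^1\cdots X^t$ with $X^i\in B_i$. For $D\in\mathbb{B}_C$, $|S_C(D)|$ is the total number, over all blocks $i$, of indices $j\in\{0,\dots,m_i-1\}$ with $x^{(i)}_{j+1}=x^{(i)}_j-1$ (where $X^i=x^{(i)}_1\cdots x^{(i)}_{m_i}$ and $x^{(i)}_0=M_i$). -}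

module Defs where

open import Data.Bool using (Bool; true; false; if_then_else_)
open import Data.Nat using (ℕ; zero; suc)
import Data.Nat as ℕ
open import Data.Integer using (ℤ; +_; -[1+_]; _+_; _-_; -_; _≤_; _<_; _≤?_; _<?_; _≟_; ∣_∣; 0ℤ; 1ℤ)
open import Data.List using (List; []; _∷_; map; concatMap; filter; foldr; upTo; length; concat)
open import Data.Vec using (Vec; []; _∷_; toList)
open import Data.Vec.Properties using (≡-dec)
open import Data.Product using (Σ; _×_; _,_)
open import Data.Unit using (⊤; tt)
open import Data.Empty using (⊥)
open import Data.Sum using (_⊎_)
open import Relation.Nullary using (Dec; yes; no; does; ¬_; ¬?)
open import Relation.Nullary.Decidable using (_×-dec_; _→-dec_)
open import Relation.Binary.PropositionalEquality using (_≡_)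

-- Words of length m are vectors Vec ℤ m.

InP : ∀ {m} → Vec ℤ m → Set
InP [] = ⊤
InP (x ∷ []) = ⊤
InP (x ∷ y ∷ ys) = y ≤ x × InP (y ∷ ys)

AdjOK : ∀ {m} → ℤ → ℤ → Vec ℤ m → Vec ℤ m → Set
AdjOK d c [] [] = ⊤
AdjOK d c (d' ∷ _) (c' ∷ _) = c' < c → d' < d

_≤m_ : ∀ {m} → Vec ℤ m → Vec ℤ m → Set
[] ≤m [] = ⊤
(d ∷ ds) ≤m (c ∷ cs) = d ≤ c × AdjOK d c ds cs × ds ≤m cs

infix 4 _≤m_

InP? : ∀ {m} (C : Vec ℤ m) → Dec (InP C)
InP? [] = yes tt
InP? (x ∷ []) = yes tt
InP? (x ∷ y ∷ ys) = (y ≤? x) ×-dec InP? (y ∷ ys)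

AdjOK? : ∀ {m} d c (ds cs : Vec ℤ m) → Dec (AdjOK d c ds cs)
AdjOK? d c [] [] = yes tt
AdjOK? d c (d' ∷ _) (c' ∷ _) = (c' <? c) →-dec (d' <? d)

_≤m?_ : ∀ {m} (D C : Vec ℤ m) → Dec (D ≤m C)
[] ≤m? [] = yes tt
(d ∷ ds) ≤m? (c ∷ cs) = (d ≤? c) ×-dec AdjOK? d c ds cs ×-dec (ds ≤m? cs)

rangeℤ : ℤ → ℤ → List ℤ
rangeℤ a b with b - a
... | + n = map (λ k → a + + k) (upTo (suc n))
... | -[1+ n ] = []

box : ∀ {m} → Vec ℤ m → Vec ℤ m → List (Vec ℤ m)
box [] [] = [] ∷ []
box (d ∷ ds) (c ∷ cs) = concatMap (λ x → map (x ∷_) (box ds cs)) (rangeℤ d c)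

belowStrict : ∀ {m} → Vec ℤ m → Vec ℤ m → List (Vec ℤ m)
belowStrict D C =
  filter (λ E → InP? E ×-dec (D ≤m? E) ×-dec (E ≤m? C) ×-dec ¬? (≡-dec _≟_ E C))
         (box D C)

sumℤ : List ℤ → ℤ
sumℤ = foldr _+_ 0ℤ

-- Σ_i |C_i - D_i|, bounds the length of chains in [D, C]
dist : ∀ {m} → Vec ℤ m → Vec ℤ m → ℕ
dist [] [] = 0
dist (d ∷ ds) (c ∷ cs) = ∣ c - d ∣ ℕ.+ dist ds cs

mobiusF : ∀ {m} → ℕ → Vec ℤ m → Vec ℤ m → ℤ
mobiusF zero D C = 0ℤ
mobiusF (suc f) D C =
  if does (≡-dec _≟_ D C) then 1ℤ
  else (if does (D ≤m? C) then - sumℤ (map (mobiusF f D) (belowStrict D C)) else 0ℤ)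

-- Möbius function of (𝒫_m, ≤_m); fuel dist D C + 1 suffices since every
-- recursive call strictly decreases dist D E.
μ : ∀ {m} → Vec ℤ m → Vec ℤ m → ℤ
μ D C = mobiusF (suc (dist D C)) D C

-- run-length grouping: C = M_1^{m_1} ⋯ M_t^{m_t}, as list of (M_i , m_i)
consRun : ℤ → List (ℤ × ℕ) → List (ℤ × ℕ)
consRun x [] = (x , 1) ∷ []
consRun x ((y , k) ∷ r) = if does (x ≟ y) then (y , suc k) ∷ r else (x , 1) ∷ (y , k) ∷ r

runs : List ℤ → List (ℤ × ℕ)
runs [] = []
runs (x ∷ xs) = consRun x (runs xs)

Chain : ℤ → List ℤ → Set
Chain x₀ [] = ⊤
Chain x₀ (x ∷ xs) = (x ≡ x₀ ⊎ x ≡ x₀ - 1ℤ) × Chain x xs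

endOf : ℤ → List ℤ → ℤ
endOf x₀ [] = x₀
endOf x₀ (x ∷ xs) = endOf x xs

NextOK : List (ℤ × ℕ) → ℤ → Set
NextOK [] e = ⊤
NextOK ((N , _) ∷ _) e = N < e

AllBlocks : List (ℤ × ℕ) → List (List ℤ) → Set
AllBlocks [] [] = ⊤
AllBlocks [] (_ ∷ _) = ⊥
AllBlocks (_ ∷ _) [] = ⊥
AllBlocks ((M , k) ∷ bs) (X ∷ Xs) =
  length X ≡ k × Chain M X × NextOK bs (endOf M X) × AllBlocks bs Xs

-- D = X^1 ⋯ X^t with X^i ∈ B_i
Decomp : ∀ {m} → Vec ℤ m → Vec ℤ m → List (List ℤ) → Set
Decomp C D Xs = concat Xs ≡ toList D × AllBlocks (runs (toList C)) Xs

_∈𝔹_ : ∀ {m} → Vec ℤ m → Vec ℤ m → Set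
D ∈𝔹 C = Σ (List (List ℤ)) (Decomp C D)

descents : ℤ → List ℤ → ℕ
descents x₀ [] = 0
descents x₀ (x ∷ xs) = (if does (x ≟ x₀ - 1ℤ) then 1 else 0) ℕ.+ descents x xs

-- |S_C(D)| computed from the block decomposition X^1 ⋯ X^t
Scount : List (ℤ × ℕ) → List (List ℤ) → ℕ
Scount [] _ = 0
Scount (_ ∷ _) [] = 0
Scount ((M , _) ∷ bs) (X ∷ Xs) = descents M X ℕ.+ Scount bs Xs

-- Let μℤ be the Möbius function of the chain ℤ (μℤ x x = 1, μℤ (x - 1) x = -1, and 0 otherwise)
-- and, for D ≤ E, let μ-formula D E be μℤ d₁ e₁ times one factor for each later position i: the
-- factor is μℤ dᵢ dᵢ₋₁ if eᵢ = eᵢ₋₁, and μℤ dᵢ eᵢ if E starts a new run at i and eᵢ < dᵢ₋₁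
-- (0 otherwise). It is 1 on the diagonal and sums to 0 over every interval [D, C] with D < C,
-- so it is the Möbius function.
--
-- The interval sum is computed from the right, like a transfer matrix: once the letters of D, E
-- and C at position i - 1 are fixed, the sum over positions i, …, m is a product of local sums,
-- one per position, that does not depend on the letter of E at position i - 1. Prepending to D,
-- E and C a letter larger than every letter of C turns the whole interval sum into such a tail
-- sum, and its local sum at the first position where D and C differ vanishes.
--
-- Along the runs M₁^{m₁} ⋯ M_t^{m_t} of C, the factors of μ-formula D C inside the i-th run are
-- nonzero exactly when that piece of D lies in Bᵢ, and every factor -1 is a step of S_C(D).

module Submission where

open import Defs
open import Data.Bool using (Bool; true; false; if_then_else_; _∧_; not)
open import Data.Nat as ℕ using (ℕ; zero; suc)
import Data.Nat.Properties as ℕP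
open import Data.Integer
  using (ℤ; +_; -[1+_]; +≤+; _+_; _-_; -_; _*_; _≤_; _<_; _≤?_; _<?_; _≟_; ∣_∣; 0ℤ; 1ℤ; _^_)
import Data.Integer.Properties as ℤP
open import Data.Integer.Tactic.RingSolver using (solve-∀)
open import Data.List using (List; []; _∷_; map; concatMap; filter; upTo; applyUpTo; length; concat; _++_)
open import Data.List.Properties using (map-cong; map-cong-local; map-∘; map-upTo; map-applyUpTo)
open import Data.List.Relation.Unary.All as All using (All; []; _∷_)
open import Data.Vec using (Vec; []; _∷_; toList)
open import Data.Vec.Properties using (≡-dec)
open import Data.Product using (Σ; _×_; _,_)
open import Data.Sum using (_⊎_; inj₁; inj₂)
open import Data.Unit using (tt)
open import Data.Empty using (⊥-elim)
open import Function using (_∘_; _⇔_; mk⇔; Equivalence)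
open import Relation.Nullary using (Dec; yes; no; does; ¬_; ¬?; contradiction)
open import Relation.Nullary.Decidable using (dec-true; dec-false; does-⇔; _×-dec_; _→-dec_)
open import Relation.Binary.PropositionalEquality
  using (_≡_; _≢_; refl; sym; trans; cong; cong₂; subst; subst₂; module ≡-Reasoning)

open ≡-Reasoning

private variable
  A B : Set
  n : ℕ

x≡1+[x-1] : ∀ x → x ≡ 1ℤ + (x - 1ℤ)
x≡1+[x-1] = solve-∀

x-1<x : ∀ x → x - 1ℤ < x
x-1<x x = ℤP.suc[i]≤j⇒i<j (ℤP.≤-reflexive (sym (x≡1+[x-1] x)))

x<1+x : ∀ x → x < 1ℤ + x
x<1+x x = ℤP.suc[i]≤j⇒i<j ℤP.≤-refl

[1+x]-1≡x : ∀ x → (1ℤ + x) - 1ℤ ≡ x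
[1+x]-1≡x = solve-∀

∣-∣-mono-≤ : ∀ {i j} → 0ℤ ≤ i → i ≤ j → ∣ i ∣ ℕ.≤ ∣ j ∣
∣-∣-mono-≤ 0≤i i≤j =
  ℤP.drop‿+≤+ (subst₂ _≤_ (sym (ℤP.0≤i⇒+∣i∣≡i 0≤i))
                          (sym (ℤP.0≤i⇒+∣i∣≡i (ℤP.≤-trans 0≤i i≤j))) i≤j)

∣-∣-mono-< : ∀ {i j} → 0ℤ ≤ i → i < j → ∣ i ∣ ℕ.< ∣ j ∣
∣-∣-mono-< 0≤i i<j =
  ℤP.drop‿+<+ (subst₂ _<_ (sym (ℤP.0≤i⇒+∣i∣≡i 0≤i))
                          (sym (ℤP.0≤i⇒+∣i∣≡i (ℤP.≤-trans 0≤i (ℤP.<⇒≤ i<j)))) i<j)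

*≢0 : ∀ a b → a * b ≢ 0ℤ → a ≢ 0ℤ × b ≢ 0ℤ
*≢0 a b ab≢0 = (λ { refl → ab≢0 refl }) , (λ { refl → ab≢0 (ℤP.*-zeroʳ a) })

infixl 5 _when_

_when_ : ℤ → Bool → ℤ
v when true  = v
v when false = 0ℤ

when-∧ : ∀ a b v → v when (a ∧ b) ≡ v when b when a
when-∧ true  b v = refl
when-∧ false b v = refl

0-when : ∀ b → 0ℤ when b ≡ 0ℤ
0-when true  = refl
0-when false = refl

*-when : ∀ a v b → a * v when b ≡ a * (v when b)
*-when a v true  = refl
*-when a v false = sym (ℤP.*-zeroʳ a)

when-* : ∀ a v b → a * v when b ≡ (a when b) * v
when-* a v true  = refl
when-* a v false = sym (ℤP.*-zeroˡ v)

when-∧-last : ∀ a b c x v → v when (a ∧ b ∧ c ∧ x) ≡ v when (a ∧ b ∧ c) when x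
when-∧-last true  true  true  x v = refl
when-∧-last true  true  false x v = sym (0-when x)
when-∧-last true  false c     x v = sym (0-when x)
when-∧-last false b     c     x v = sym (0-when x)

when-not : ∀ v b → v when not b ≡ v - (v when b)
when-not v true  = sym (ℤP.+-inverseʳ v)
when-not v false = sym (ℤP.+-identityʳ v)

when-yes : ∀ {P : Set} v (p : Dec P) → P → v when does p ≡ v
when-yes v p x = cong (v when_) (dec-true p x)

when-no : ∀ {P : Set} v (p : Dec P) → ¬ P → v when does p ≡ 0ℤ
when-no v p ¬x = cong (v when_) (dec-false p ¬x)

when-⇔ : ∀ {P Q : Set} v → P ⇔ Q → (p : Dec P) (q : Dec Q) → v when does p ≡ v when does q
when-⇔ v P⇔Q p q = cong (v when_) (does-⇔ P⇔Q p q)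

when≢0 : ∀ {P : Set} v (p : Dec P) → v when does p ≢ 0ℤ → P × v ≢ 0ℤ
when≢0 v (yes p) v≢0 = p , v≢0
when≢0 v (no _)  0≢0 = contradiction refl 0≢0

δ : ℤ → ℤ → ℤ → ℤ
δ t v e = v when does (t ≟ e)

δ-≢ : ∀ {t e} v → t ≢ e → δ t v e ≡ 0ℤ
δ-≢ {t} {e} v = when-no v (t ≟ e)

δ-at : ∀ t v → δ t v t ≡ v
δ-at t v = when-yes v (t ≟ t) refl

∑ : (A → ℤ) → List A → ℤ
∑ h xs = sumℤ (map h xs)

∑-cong : {h k : A → ℤ} → (∀ x → h x ≡ k x) → ∀ xs → ∑ h xs ≡ ∑ k xs
∑-cong h≗k xs = cong sumℤ (map-cong h≗k xs)

∑-cong-local : {h k : A → ℤ} {xs : List A} → All (λ x → h x ≡ k x) xs → ∑ h xs ≡ ∑ k xs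
∑-cong-local h≗k = cong sumℤ (map-cong-local h≗k)

∑-++ : ∀ (h : A → ℤ) xs ys → ∑ h (xs ++ ys) ≡ ∑ h xs + ∑ h ys
∑-++ h []       ys = sym (ℤP.+-identityˡ _)
∑-++ h (x ∷ xs) ys = trans (cong (_+_ (h x)) (∑-++ h xs ys)) (sym (ℤP.+-assoc (h x) _ _))

∑-map : ∀ (h : B → ℤ) (g : A → B) xs → ∑ h (map g xs) ≡ ∑ (h ∘ g) xs
∑-map h g xs = cong sumℤ (sym (map-∘ xs))

∑-concatMap : ∀ (h : B → ℤ) (f : A → List B) xs →
              ∑ h (concatMap f xs) ≡ ∑ (λ x → ∑ h (f x)) xs
∑-concatMap h f []       = refl
∑-concatMap h f (x ∷ xs) =
  trans (∑-++ h (f x) (concatMap f xs)) (cong (_+_ (∑ h (f x))) (∑-concatMap h f xs))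

∑-zero : ∀ (h : A → ℤ) → (∀ x → h x ≡ 0ℤ) → ∀ xs → ∑ h xs ≡ 0ℤ
∑-zero h h≗0 []       = refl
∑-zero h h≗0 (x ∷ xs) = cong₂ _+_ (h≗0 x) (∑-zero h h≗0 xs)

∑-+ : ∀ (h k : A → ℤ) xs → ∑ (λ x → h x + k x) xs ≡ ∑ h xs + ∑ k xs
∑-+ h k []       = refl
∑-+ h k (x ∷ xs) = trans (cong (_+_ (h x + k x)) (∑-+ h k xs)) (interchange (h x) (k x) _ _)
  where
  interchange : ∀ a b c d → (a + b) + (c + d) ≡ (a + c) + (b + d)
  interchange = solve-∀

∑-- : ∀ (h k : A → ℤ) xs → ∑ (λ x → h x - k x) xs ≡ ∑ h xs - ∑ k xs
∑-- h k []       = refl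
∑-- h k (x ∷ xs) = trans (cong (_+_ (h x - k x)) (∑-- h k xs)) (interchange (h x) (k x) _ _)
  where
  interchange : ∀ a b c d → (a - b) + (c - d) ≡ (a + c) - (b + d)
  interchange = solve-∀

∑-*ˡ : ∀ a (h : A → ℤ) xs → ∑ (λ x → a * h x) xs ≡ a * ∑ h xs
∑-*ˡ a h []       = sym (ℤP.*-zeroʳ a)
∑-*ˡ a h (x ∷ xs) = trans (cong (_+_ (a * h x)) (∑-*ˡ a h xs)) (sym (ℤP.*-distribˡ-+ a (h x) _))

∑-*ʳ : ∀ a (h : A → ℤ) xs → ∑ (λ x → h x * a) xs ≡ ∑ h xs * a
∑-*ʳ a h []       = refl
∑-*ʳ a h (x ∷ xs) = trans (cong (_+_ (h x * a)) (∑-*ʳ a h xs)) (sym (ℤP.*-distribʳ-+ a (h x) _))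

∑-when : ∀ b (h : A → ℤ) xs → ∑ (λ x → h x when b) xs ≡ ∑ h xs when b
∑-when true  h xs = refl
∑-when false h xs = ∑-zero _ (λ _ → refl) xs

∑-filter : ∀ {P : A → Set} (P? : ∀ x → Dec (P x)) (h : A → ℤ) xs →
           ∑ h (filter P? xs) ≡ ∑ (λ x → h x when does (P? x)) xs
∑-filter P? h []       = refl
∑-filter P? h (x ∷ xs) with does (P? x)
... | true  = cong (_+_ (h x)) (∑-filter P? h xs)
... | false = trans (∑-filter P? h xs) (sym (ℤP.+-identityˡ _))

upFrom : ℤ → ℕ → List ℤ
upFrom a zero    = a ∷ []
upFrom a (suc n) = a ∷ upFrom (1ℤ + a) n

1+a+n≡a+[1+n] : ∀ a n → (1ℤ + a) + + n ≡ a + + suc n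
1+a+n≡a+[1+n] a n = shift a (+ n)
  where
  shift : ∀ a x → (1ℤ + a) + x ≡ a + (1ℤ + x)
  shift = solve-∀

map-+-upTo : ∀ a n → map (λ k → a + + k) (upTo (suc n)) ≡ upFrom a n
map-+-upTo a zero    = cong (_∷ []) (ℤP.+-identityʳ a)
map-+-upTo a (suc n) = cong₂ _∷_ (ℤP.+-identityʳ a) (begin
  map (λ k → a + + k) (applyUpTo suc (suc n))  ≡⟨ map-applyUpTo suc _ (suc n) ⟩
  applyUpTo (λ k → a + + suc k) (suc n)       ≡⟨ map-upTo _ (suc n) ⟨
  map (λ k → a + + suc k) (upTo (suc n))      ≡⟨ map-cong (λ k → sym (1+a+n≡a+[1+n] a k)) (upTo (suc n)) ⟩
  map (λ k → (1ℤ + a) + + k) (upTo (suc n))   ≡⟨ map-+-upTo (1ℤ + a) n ⟩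
  upFrom (1ℤ + a) n                           ∎)

rangeℤ-≤ : ∀ a b → a ≤ b → rangeℤ a b ≡ upFrom a ∣ b - a ∣
rangeℤ-≤ a b a≤b with b - a in eq
... | + n      = map-+-upTo a n
... | -[1+ n ] = contradiction (subst (0ℤ ≤_) eq (ℤP.i≤j⇒0≤j-i a≤b)) λ ()

rangeℤ-> : ∀ a b → b < a → rangeℤ a b ≡ []
rangeℤ-> a b b<a with b - a in eq
... | + n      = contradiction (ℤP.0≤i-j⇒j≤i (subst (0ℤ ≤_) (sym eq) (+≤+ ℕ.z≤n))) (ℤP.<⇒≱ b<a)
... | -[1+ n ] = refl

a+∣b-a∣≡b : ∀ {a b} → a ≤ b → a + + ∣ b - a ∣ ≡ b
a+∣b-a∣≡b {a} {b} a≤b =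
  trans (cong (_+_ a) (ℤP.0≤i⇒+∣i∣≡i (ℤP.i≤j⇒0≤j-i a≤b))) (a+[b-a]≡b a b)
  where
  a+[b-a]≡b : ∀ a b → a + (b - a) ≡ b
  a+[b-a]≡b = solve-∀

upFrom-bounded : ∀ a n → All (λ x → a ≤ x × x ≤ a + + n) (upFrom a n)
upFrom-bounded a zero    = (ℤP.≤-refl , ℤP.i≤i+j a (+ 0)) ∷ []
upFrom-bounded a (suc n) = (ℤP.≤-refl , ℤP.i≤i+j a (+ suc n)) ∷ All.map widen (upFrom-bounded (1ℤ + a) n)
  where
  widen : ∀ {x} → 1ℤ + a ≤ x × x ≤ (1ℤ + a) + + n → a ≤ x × x ≤ a + + suc n
  widen {x} (1+a≤x , x≤) = ℤP.≤-trans (ℤP.i≤j+i a 1ℤ) 1+a≤x , subst (x ≤_) (1+a+n≡a+[1+n] a n) x≤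

rangeℤ-bounded : ∀ a b → All (λ x → a ≤ x × x ≤ b) (rangeℤ a b)
rangeℤ-bounded a b with a ≤? b
... | yes a≤b rewrite rangeℤ-≤ a b a≤b =
  All.map (λ (a≤x , x≤) → a≤x , subst (_ ≤_) (a+∣b-a∣≡b a≤b) x≤) (upFrom-bounded a _)
... | no a≰b rewrite rangeℤ-> a b (ℤP.≰⇒> a≰b) = []

∑-δ-upFrom : ∀ t v a n → ∑ (δ t v) (upFrom a n) ≡ v when does ((a ≤? t) ×-dec (t ≤? a + + n))
∑-δ-upFrom t v a zero with t ≟ a
... | yes refl = trans (ℤP.+-identityʳ v)
  (sym (when-yes v ((t ≤? t) ×-dec (t ≤? t + + 0)) (ℤP.≤-refl , ℤP.i≤i+j t (+ 0))))
... | no t≢a   = sym (when-no v ((a ≤? t) ×-dec (t ≤? a + + 0))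
  λ (a≤t , t≤) → t≢a (ℤP.≤-antisym (subst (t ≤_) (ℤP.+-identityʳ a) t≤) a≤t))
∑-δ-upFrom t v a (suc n) with t ≟ a
... | yes refl = begin
  v + ∑ (δ t v) (upFrom (1ℤ + t) n)
    ≡⟨ cong (_+_ v) (∑-δ-upFrom t v (1ℤ + t) n) ⟩
  v + (v when does ((1ℤ + t ≤? t) ×-dec (t ≤? (1ℤ + t) + + n)))
    ≡⟨ cong (_+_ v) (when-no v ((1ℤ + t ≤? t) ×-dec (t ≤? (1ℤ + t) + + n))
                                 λ (1+t≤t , _) → ℤP.<-irrefl refl (ℤP.suc[i]≤j⇒i<j 1+t≤t)) ⟩
  v + 0ℤ
    ≡⟨ ℤP.+-identityʳ v ⟩
  v
    ≡⟨ when-yes v ((t ≤? t) ×-dec (t ≤? t + + suc n)) (ℤP.≤-refl , ℤP.i≤i+j t (+ suc n)) ⟨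
  v when does ((t ≤? t) ×-dec (t ≤? t + + suc n)) ∎
... | no t≢a = begin
  0ℤ + ∑ (δ t v) (upFrom (1ℤ + a) n)
    ≡⟨ cong (_+_ 0ℤ) (∑-δ-upFrom t v (1ℤ + a) n) ⟩
  0ℤ + (v when does ((1ℤ + a ≤? t) ×-dec (t ≤? (1ℤ + a) + + n)))
    ≡⟨ ℤP.+-identityˡ _ ⟩
  v when does ((1ℤ + a ≤? t) ×-dec (t ≤? (1ℤ + a) + + n))
    ≡⟨ when-⇔ v (mk⇔ to from) ((1ℤ + a ≤? t) ×-dec (t ≤? (1ℤ + a) + + n))
                              ((a ≤? t) ×-dec (t ≤? a + + suc n)) ⟩
  v when does ((a ≤? t) ×-dec (t ≤? a + + suc n)) ∎
  where
  to : 1ℤ + a ≤ t × t ≤ (1ℤ + a) + + n → a ≤ t × t ≤ a + + suc n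
  to (1+a≤t , t≤) = ℤP.≤-trans (ℤP.i≤j+i a 1ℤ) 1+a≤t , subst (t ≤_) (1+a+n≡a+[1+n] a n) t≤
  from : a ≤ t × t ≤ a + + suc n → 1ℤ + a ≤ t × t ≤ (1ℤ + a) + + n
  from (a≤t , t≤) =
    ℤP.i<j⇒suc[i]≤j (ℤP.≤∧≢⇒< a≤t (t≢a ∘ sym)) , subst (t ≤_) (sym (1+a+n≡a+[1+n] a n)) t≤

∑-δ-rangeℤ : ∀ t v a b → ∑ (δ t v) (rangeℤ a b) ≡ v when does ((a ≤? t) ×-dec (t ≤? b))
∑-δ-rangeℤ t v a b with a ≤? b
... | yes a≤b rewrite rangeℤ-≤ a b a≤b =
  trans (∑-δ-upFrom t v a _) (cong (λ z → v when does ((a ≤? t) ×-dec (t ≤? z))) (a+∣b-a∣≡b a≤b))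
... | no a≰b rewrite rangeℤ-> a b (ℤP.≰⇒> a≰b) =
  sym (when-no v ((a ≤? t) ×-dec (t ≤? b)) λ (a≤t , t≤b) → a≰b (ℤP.≤-trans a≤t t≤b))

∑-box : ∀ (h : Vec ℤ (suc n) → ℤ) d c (D C : Vec ℤ n) →
  ∑ h (box (d ∷ D) (c ∷ C)) ≡ ∑ (λ e → ∑ (λ E → h (e ∷ E)) (box D C)) (rangeℤ d c)
∑-box h d c D C =
  trans (∑-concatMap h _ (rangeℤ d c)) (∑-cong (λ e → ∑-map h (e ∷_) (box D C)) (rangeℤ d c))

∑-box-at : ∀ {D C : Vec ℤ n} (h : Vec ℤ n → ℤ) → D ≤m C →
  ∑ (λ E → h E when does (≡-dec _≟_ E C)) (box D C) ≡ h C
∑-box-at {D = []}    {[]}    h _                 = ℤP.+-identityʳ (h [])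
∑-box-at {D = d ∷ D} {c ∷ C} h (d≤c , _ , D≤C) = begin
  ∑ (λ E → h E when does (≡-dec _≟_ E (c ∷ C))) (box (d ∷ D) (c ∷ C))
    ≡⟨ ∑-box _ d c D C ⟩
  ∑ (λ e → ∑ (λ E → h (e ∷ E) when (does (e ≟ c) ∧ does (≡-dec _≟_ E C))) (box D C)) (rangeℤ d c)
    ≡⟨ ∑-cong (λ e → trans (∑-cong (λ E → when-∧ (does (e ≟ c)) _ _) (box D C))
                     (trans (∑-when (does (e ≟ c)) _ (box D C))
                            (cong (_when does (e ≟ c)) (∑-box-at (λ E → h (e ∷ E)) D≤C)))) (rangeℤ d c) ⟩
  ∑ (λ e → h (e ∷ C) when does (e ≟ c)) (rangeℤ d c)
    ≡⟨ ∑-cong at-c (rangeℤ d c) ⟩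
  ∑ (δ c (h (c ∷ C))) (rangeℤ d c)
    ≡⟨ ∑-δ-rangeℤ c (h (c ∷ C)) d c ⟩
  h (c ∷ C) when does ((d ≤? c) ×-dec (c ≤? c))
    ≡⟨ when-yes (h (c ∷ C)) ((d ≤? c) ×-dec (c ≤? c)) (d≤c , ℤP.≤-refl) ⟩
  h (c ∷ C) ∎
  where
  at-c : ∀ e → h (e ∷ C) when does (e ≟ c) ≡ δ c (h (c ∷ C)) e
  at-c e with e ≟ c
  ... | yes refl = sym (δ-at e (h (e ∷ C)))
  ... | no e≢c   = sym (δ-≢ (h (c ∷ C)) (e≢c ∘ sym))

-- The Möbius function of the chain ℤ and the product formula

μℤ : ℤ → ℤ → ℤ
μℤ d x = if does (d ≟ x) then 1ℤ else if does (d ≟ x - 1ℤ) then - 1ℤ else 0ℤ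

μℤ-refl : ∀ x → μℤ x x ≡ 1ℤ
μℤ-refl x rewrite dec-true (x ≟ x) refl = refl

μℤ-pred : ∀ x → μℤ (x - 1ℤ) x ≡ - 1ℤ
μℤ-pred x rewrite dec-false (x - 1ℤ ≟ x) (ℤP.<⇒≢ (x-1<x x)) | dec-true (x - 1ℤ ≟ x - 1ℤ) refl = refl

μℤ-≢ : ∀ {d x} → d ≢ x → d ≢ x - 1ℤ → μℤ d x ≡ 0ℤ
μℤ-≢ {d} {x} d≢x d≢x-1 rewrite dec-false (d ≟ x) d≢x | dec-false (d ≟ x - 1ℤ) d≢x-1 = refl

μℤ≢0 : ∀ d x → μℤ d x ≢ 0ℤ → d ≡ x ⊎ d ≡ x - 1ℤ
μℤ≢0 d x μ≢0 with d ≟ x | d ≟ x - 1ℤ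
... | yes d≡x | _        = inj₁ d≡x
... | no _    | yes d≡x-1 = inj₂ d≡x-1
... | no _    | no _      = contradiction refl μ≢0

μℤ-below : ∀ {d dp} → d < dp → ∀ e →
  μℤ d e when does (e <? dp) ≡ δ d 1ℤ e - δ (1ℤ + d) (1ℤ when does (1ℤ + d <? dp)) e
μℤ-below {d} {dp} d<dp e with d ≟ e
... | yes refl rewrite dec-true (e <? dp) d<dp | dec-false (1ℤ + e ≟ e) (ℤP.<⇒≢ (x<1+x e) ∘ sym) = refl
... | no d≢e with 1ℤ + d ≟ e
...   | yes refl rewrite dec-true (d ≟ (1ℤ + d) - 1ℤ) (sym ([1+x]-1≡x d)) = -1-when (does (1ℤ + d <? dp))
  where
  -1-when : ∀ b → - 1ℤ when b ≡ 0ℤ - (1ℤ when b)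
  -1-when true  = refl
  -1-when false = refl
...   | no 1+d≢e
  rewrite dec-false (d ≟ e - 1ℤ) (λ d≡e-1 → 1+d≢e (trans (cong (_+_ 1ℤ) d≡e-1) (sym (x≡1+[x-1] e)))) =
  0-when (does (e <? dp))

μℤ-chain-step : ∀ x y → y ≡ x ⊎ y ≡ x - 1ℤ →
  μℤ y x ≡ (- 1ℤ) ^ (if does (y ≟ x - 1ℤ) then 1 else 0)
μℤ-chain-step x .x        (inj₁ refl)
  rewrite dec-true (x ≟ x) refl | dec-false (x ≟ x - 1ℤ) (ℤP.<⇒≢ (x-1<x x) ∘ sym) = refl
μℤ-chain-step x .(x - 1ℤ) (inj₂ refl)
  rewrite dec-false (x - 1ℤ ≟ x) (ℤP.<⇒≢ (x-1<x x)) | dec-true (x - 1ℤ ≟ x - 1ℤ) refl = refl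

μ-factor : ℤ → ℤ → ℤ → ℤ → ℤ
μ-factor dp ep d e =
  if does (ep ≟ e) then μℤ d dp else (μℤ d e when does (e <? dp))

μ-factor-new-run : ∀ {dp ep d e} → ep ≢ e → e < dp → μ-factor dp ep d e ≡ μℤ d e
μ-factor-new-run {dp} {ep} {d} {e} ep≢e e<dp rewrite dec-false (ep ≟ e) ep≢e | dec-true (e <? dp) e<dp = refl

μ-factor-refl : ∀ {dp d} → d ≤ dp → μ-factor dp dp d d ≡ 1ℤ
μ-factor-refl {dp} {d} d≤dp with dp ≟ d
... | yes refl = μℤ-refl dp
... | no dp≢d rewrite dec-true (d <? dp) (ℤP.≤∧≢⇒< d≤dp (dp≢d ∘ sym)) = μℤ-refl d

μ-formula-after : ℤ → ℤ → Vec ℤ n → Vec ℤ n → ℤ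
μ-formula-after dp ep []      []      = 1ℤ
μ-formula-after dp ep (d ∷ D) (e ∷ E) = μ-factor dp ep d e * μ-formula-after d e D E

μ-formula : Vec ℤ n → Vec ℤ n → ℤ
μ-formula []      []      = 1ℤ
μ-formula (d ∷ D) (e ∷ E) = μℤ d e * μ-formula-after d e D E

μ-formula-after-refl : ∀ {dp} {D : Vec ℤ n} → InP (dp ∷ D) → μ-formula-after dp dp D D ≡ 1ℤ
μ-formula-after-refl {D = []}    _            = refl
μ-formula-after-refl {D = d ∷ D} (d≤dp , D∈) = cong₂ _*_ (μ-factor-refl d≤dp) (μ-formula-after-refl D∈)

μ-formula-refl : ∀ {D : Vec ℤ n} → InP D → μ-formula D D ≡ 1ℤ
μ-formula-refl {D = []}    _  = refl
μ-formula-refl {D = d ∷ D} D∈ = cong₂ _*_ (μℤ-refl d) (μ-formula-after-refl D∈)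

-- Summing the product formula over an interval

_∈[_,_] : Vec ℤ n → Vec ℤ n → Vec ℤ n → Set
E ∈[ D , C ] = InP E × D ≤m E × E ≤m C

_∈[_,_]? : (E D C : Vec ℤ n) → Dec (E ∈[ D , C ])
E ∈[ D , C ]? = InP? E ×-dec (D ≤m? E) ×-dec (E ≤m? C)

≤m-refl : ∀ (C : Vec ℤ n) → C ≤m C
≤m-refl []          = tt
≤m-refl (c ∷ [])    = ℤP.≤-refl , tt , tt
≤m-refl (c ∷ c′ ∷ C) = ℤP.≤-refl , (λ c′<c → c′<c) , ≤m-refl (c′ ∷ C)

Link : ℤ → ℤ → ℤ → ℤ → ℤ → ℤ → Set
Link dp ep cp d e c = e ≤ ep × dp ≤ ep × (e < ep → d < dp) × ep ≤ cp × (c < cp → e < ep)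

Link? : ∀ dp ep cp d e c → Dec (Link dp ep cp d e c)
Link? dp ep cp d e c =
  (e ≤? ep) ×-dec (dp ≤? ep) ×-dec ((e <? ep) →-dec (d <? dp)) ×-dec
  (ep ≤? cp) ×-dec ((c <? cp) →-dec (e <? ep))

∈[]-∷ : ∀ dp ep cp d e c (D E C : Vec ℤ n) →
  does ((ep ∷ e ∷ E) ∈[ dp ∷ d ∷ D , cp ∷ c ∷ C ]?)
    ≡ does (Link? dp ep cp d e c) ∧ does ((e ∷ E) ∈[ d ∷ D , c ∷ C ]?)
∈[]-∷ dp ep cp d e c D E C = does-⇔ (mk⇔
  (λ ((e≤ep , E∈) , (dp≤ep , adj₁ , D≤) , (ep≤cp , adj₂ , ≤C)) →
     (e≤ep , dp≤ep , adj₁ , ep≤cp , adj₂) , (E∈ , D≤ , ≤C))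
  (λ ((e≤ep , dp≤ep , adj₁ , ep≤cp , adj₂) , (E∈ , D≤ , ≤C)) →
     (e≤ep , E∈) , (dp≤ep , adj₁ , D≤) , (ep≤cp , adj₂ , ≤C)))
  ((ep ∷ e ∷ E) ∈[ dp ∷ d ∷ D , cp ∷ c ∷ C ]?) (Link? dp ep cp d e c ×-dec (e ∷ E) ∈[ d ∷ D , c ∷ C ]?)

∈[]-sentinel : ∀ {M d e c} {D E C : Vec ℤ n} → c < M →
  (e ∷ E) ∈[ d ∷ D , c ∷ C ] ⇔ (M ∷ e ∷ E) ∈[ M ∷ d ∷ D , M ∷ c ∷ C ]
∈[]-sentinel c<M = mk⇔
  (λ (E∈ , D≤E@(d≤e , _) , E≤C@(e≤c , _)) → let e<M = ℤP.≤-<-trans e≤c c<M in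
    (ℤP.<⇒≤ e<M , E∈) , (ℤP.≤-refl , (λ _ → ℤP.≤-<-trans d≤e e<M) , D≤E) ,
    (ℤP.≤-refl , (λ _ → e<M) , E≤C))
  (λ ((_ , E∈) , (_ , _ , D≤E) , (_ , _ , E≤C)) → E∈ , D≤E , E≤C)

-- The letter e = ep contributes only if the run of C continues (c = cp); the letters e = d and
-- e = d + 1 contribute only below dp.
localSum : ℤ → ℤ → ℤ → ℤ → ℤ
localSum dp cp d c =
  (μℤ d dp when not (does (c <? cp)))
  + ((1ℤ - (1ℤ when does ((1ℤ + d ≤? c) ×-dec (1ℤ + d <? dp)))) when does (d <? dp))

localSums : ℤ → ℤ → Vec ℤ n → Vec ℤ n → ℤ
localSums dp cp []      []      = 1ℤ
localSums dp cp (d ∷ D) (c ∷ C) = localSum dp cp d c * localSums d c D C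

link-factor : ∀ {dp ep cp d c} → dp ≤ ep → ep ≤ cp → ∀ e →
  μ-factor dp ep d e when does (Link? dp ep cp d e c)
    ≡ δ ep (μℤ d dp when not (does (c <? cp))) e + (μℤ d e when does (e <? dp) when does (d <? dp))
link-factor {dp} {ep} {cp} {d} {c} dp≤ep ep≤cp e with ep ≟ e
... | yes refl rewrite dec-false (e <? dp) (ℤP.≤⇒≯ dp≤ep) = trans
  (when-⇔ (μℤ d dp) (mk⇔ (λ (_ , _ , _ , _ , adj) → ℤP.i≮i ∘ adj)
                          λ c≮cp → ℤP.≤-refl , dp≤ep , (⊥-elim ∘ ℤP.i≮i) , ep≤cp , (⊥-elim ∘ c≮cp))
    (Link? dp e cp d e c) (¬? (c <? cp)))
  (sym (trans (cong (_+_ (μℤ d dp when not (does (c <? cp)))) (0-when (does (d <? dp)))) (ℤP.+-identityʳ _)))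
... | no ep≢e with e <? dp
...   | yes e<dp = trans
  (when-⇔ (μℤ d e) (mk⇔ (λ (_ , _ , adj , _ , _) → adj e<ep)
                         λ d<dp → ℤP.<⇒≤ e<ep , dp≤ep , (λ _ → d<dp) , ep≤cp , (λ _ → e<ep))
    (Link? dp ep cp d e c) (d <? dp))
  (sym (ℤP.+-identityˡ _))
  where
  e<ep : e < ep
  e<ep = ℤP.<-≤-trans e<dp dp≤ep
...   | no _ =
  trans (0-when (does (Link? dp ep cp d e c))) (sym (trans (ℤP.+-identityˡ _) (0-when (does (d <? dp)))))

∑-link : ∀ {dp ep cp d c} → dp ≤ ep → ep ≤ cp → d ≤ dp → d ≤ c → c ≤ cp →
  ∑ (λ e → μ-factor dp ep d e when does (Link? dp ep cp d e c)) (rangeℤ d c) ≡ localSum dp cp d c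
∑-link {dp} {ep} {cp} {d} {c} dp≤ep ep≤cp d≤dp d≤c c≤cp = begin
  ∑ (λ e → μ-factor dp ep d e when does (Link? dp ep cp d e c)) (rangeℤ d c)
    ≡⟨ ∑-cong (link-factor {cp = cp} {d} {c} dp≤ep ep≤cp) (rangeℤ d c) ⟩
  ∑ (λ e → δ ep X e + (μℤ d e when does (e <? dp) when does (d <? dp))) (rangeℤ d c)
    ≡⟨ ∑-+ (δ ep X) _ (rangeℤ d c) ⟩
  ∑ (δ ep X) (rangeℤ d c) + ∑ (λ e → μℤ d e when does (e <? dp) when does (d <? dp)) (rangeℤ d c)
    ≡⟨ cong₂ _+_ (∑-δ-rangeℤ ep X d c) (∑-when (does (d <? dp)) _ (rangeℤ d c)) ⟩
  (X when does ((d ≤? ep) ×-dec (ep ≤? c)))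
  + (∑ (λ e → μℤ d e when does (e <? dp)) (rangeℤ d c) when does (d <? dp))
    ≡⟨ cong₂ _+_ (run-continues (c <? cp)) (runs-below (d <? dp)) ⟩
  localSum dp cp d c ∎
  where
  X = μℤ d dp when not (does (c <? cp))

  run-continues : (c<?cp : Dec (c < cp)) →
    μℤ d dp when not (does c<?cp) when does ((d ≤? ep) ×-dec (ep ≤? c)) ≡ μℤ d dp when not (does c<?cp)
  run-continues (yes _)   = 0-when _
  run-continues (no c≮cp) = when-yes (μℤ d dp) ((d ≤? ep) ×-dec (ep ≤? c))
    (ℤP.≤-trans d≤dp dp≤ep , ℤP.≤-trans ep≤cp (ℤP.≮⇒≥ c≮cp))

  runs-below : (d<?dp : Dec (d < dp)) →
    ∑ (λ e → μℤ d e when does (e <? dp)) (rangeℤ d c) when does d<?dp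
      ≡ (1ℤ - (1ℤ when does ((1ℤ + d ≤? c) ×-dec (1ℤ + d <? dp)))) when does d<?dp
  runs-below (no _)     = refl
  runs-below (yes d<dp) = begin
    ∑ (λ e → μℤ d e when does (e <? dp)) (rangeℤ d c)
      ≡⟨ ∑-cong (μℤ-below d<dp) (rangeℤ d c) ⟩
    ∑ (λ e → δ d 1ℤ e - δ (1ℤ + d) Y e) (rangeℤ d c)
      ≡⟨ ∑-- (δ d 1ℤ) (δ (1ℤ + d) Y) (rangeℤ d c) ⟩
    ∑ (δ d 1ℤ) (rangeℤ d c) - ∑ (δ (1ℤ + d) Y) (rangeℤ d c)
      ≡⟨ cong₂ _-_ (∑-δ-rangeℤ d 1ℤ d c) (∑-δ-rangeℤ (1ℤ + d) Y d c) ⟩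
    (1ℤ when does ((d ≤? d) ×-dec (d ≤? c))) - (Y when does ((d ≤? 1ℤ + d) ×-dec (1ℤ + d ≤? c)))
      ≡⟨ cong₂ _-_ (when-yes 1ℤ ((d ≤? d) ×-dec (d ≤? c)) (ℤP.≤-refl , d≤c))
                   (cong (λ b → Y when (b ∧ does (1ℤ + d ≤? c)))
                         (dec-true (d ≤? 1ℤ + d) (ℤP.<⇒≤ (x<1+x d)))) ⟩
    1ℤ - (Y when does (1ℤ + d ≤? c))
      ≡⟨ cong (_-_ 1ℤ) (when-∧ (does (1ℤ + d ≤? c)) (does (1ℤ + d <? dp)) 1ℤ) ⟨
    1ℤ - (1ℤ when does ((1ℤ + d ≤? c) ×-dec (1ℤ + d <? dp))) ∎
    where
    Y = 1ℤ when does (1ℤ + d <? dp)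

∑-interval-after : ∀ {dp ep cp} {D C : Vec ℤ n} →
  dp ≤ ep → ep ≤ cp → InP (dp ∷ D) → InP (cp ∷ C) → D ≤m C →
  ∑ (λ E → μ-formula-after dp ep D E when does ((ep ∷ E) ∈[ dp ∷ D , cp ∷ C ]?)) (box D C)
    ≡ localSums dp cp D C
∑-interval-after {dp = dp} {ep} {cp} {[]} {[]} dp≤ep ep≤cp _ _ _ =
  trans (ℤP.+-identityʳ _)
        (when-yes 1ℤ ((ep ∷ []) ∈[ dp ∷ [] , cp ∷ [] ]?) (tt , (dp≤ep , tt , tt) , (ep≤cp , tt , tt)))
∑-interval-after {dp = dp} {ep} {cp} {d ∷ D} {c ∷ C}
                 dp≤ep ep≤cp (d≤dp , D∈) (c≤cp , C∈) (d≤c , _ , D≤C) = begin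
  ∑ (λ E → μ-formula-after dp ep (d ∷ D) E when does ((ep ∷ E) ∈[ dp ∷ d ∷ D , cp ∷ c ∷ C ]?))
    (box (d ∷ D) (c ∷ C))
    ≡⟨ ∑-box _ d c D C ⟩
  ∑ (λ e → ∑ (λ E → μ-factor dp ep d e * μ-formula-after d e D E
                      when does ((ep ∷ e ∷ E) ∈[ dp ∷ d ∷ D , cp ∷ c ∷ C ]?)) (box D C)) (rangeℤ d c)
    ≡⟨ ∑-cong (λ e → trans (∑-cong (split e) (box D C)) (factor e)) (rangeℤ d c) ⟩
  ∑ (λ e → μ-factor dp ep d e * ∑ (λ E → μ-formula-after d e D E when does ((e ∷ E) ∈[ d ∷ D , c ∷ C ]?))
                                    (box D C)
             when does (Link? dp ep cp d e c)) (rangeℤ d c)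
    ≡⟨ ∑-cong-local (All.map inner-sum (rangeℤ-bounded d c)) ⟩
  ∑ (λ e → μ-factor dp ep d e * localSums d c D C when does (Link? dp ep cp d e c)) (rangeℤ d c)
    ≡⟨ ∑-cong (λ e → when-* (μ-factor dp ep d e) (localSums d c D C) (does (Link? dp ep cp d e c)))
              (rangeℤ d c) ⟩
  ∑ (λ e → (μ-factor dp ep d e when does (Link? dp ep cp d e c)) * localSums d c D C) (rangeℤ d c)
    ≡⟨ ∑-*ʳ (localSums d c D C) _ (rangeℤ d c) ⟩
  ∑ (λ e → μ-factor dp ep d e when does (Link? dp ep cp d e c)) (rangeℤ d c) * localSums d c D C
    ≡⟨ cong (_* localSums d c D C) (∑-link dp≤ep ep≤cp d≤dp d≤c c≤cp) ⟩
  localSum dp cp d c * localSums d c D C ∎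
  where
  split : ∀ e E →
    μ-factor dp ep d e * μ-formula-after d e D E when does ((ep ∷ e ∷ E) ∈[ dp ∷ d ∷ D , cp ∷ c ∷ C ]?)
      ≡ μ-factor dp ep d e * (μ-formula-after d e D E when does ((e ∷ E) ∈[ d ∷ D , c ∷ C ]?))
          when does (Link? dp ep cp d e c)
  split e E = begin
    _ ≡⟨ cong (μ-factor dp ep d e * μ-formula-after d e D E when_) (∈[]-∷ dp ep cp d e c D E C) ⟩
    _ ≡⟨ when-∧ (does (Link? dp ep cp d e c)) _ _ ⟩
    _ ≡⟨ cong (_when does (Link? dp ep cp d e c)) (*-when (μ-factor dp ep d e) _ _) ⟩
    _ ∎

  factor : ∀ e →
    ∑ (λ E → μ-factor dp ep d e * (μ-formula-after d e D E when does ((e ∷ E) ∈[ d ∷ D , c ∷ C ]?))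
               when does (Link? dp ep cp d e c)) (box D C)
      ≡ μ-factor dp ep d e * ∑ (λ E → μ-formula-after d e D E when does ((e ∷ E) ∈[ d ∷ D , c ∷ C ]?))
                                 (box D C)
          when does (Link? dp ep cp d e c)
  factor e = trans (∑-when (does (Link? dp ep cp d e c)) _ (box D C))
                   (cong (_when does (Link? dp ep cp d e c)) (∑-*ˡ (μ-factor dp ep d e) _ (box D C)))

  inner-sum : ∀ {e} → d ≤ e × e ≤ c →
    μ-factor dp ep d e * ∑ (λ E → μ-formula-after d e D E when does ((e ∷ E) ∈[ d ∷ D , c ∷ C ]?)) (box D C)
      when does (Link? dp ep cp d e c)
      ≡ μ-factor dp ep d e * localSums d c D C when does (Link? dp ep cp d e c)
  inner-sum {e} (d≤e , e≤c) = cong (λ s → μ-factor dp ep d e * s when does (Link? dp ep cp d e c))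
    (∑-interval-after d≤e e≤c D∈ C∈ D≤C)

localSum-diagonal : ∀ {x d c} → d < c → c ≤ x → localSum x x d c ≡ 0ℤ
localSum-diagonal {x} {d} {c} d<c c≤x
  rewrite dec-true (d <? x) (ℤP.<-≤-trans d<c c≤x) | dec-true (1ℤ + d ≤? c) (ℤP.i<j⇒suc[i]≤j d<c) with c <? x
... | yes c<x rewrite dec-true (1ℤ + d <? x) (ℤP.≤-<-trans (ℤP.i<j⇒suc[i]≤j d<c) c<x) = refl
... | no c≮x = diagonal (1ℤ + d <? x)
  where
  diagonal : (1+d<?x : Dec (1ℤ + d < x)) → μℤ d x + (1ℤ - (1ℤ when does 1+d<?x)) ≡ 0ℤ
  diagonal (yes 1+d<x) = cong (_+ 0ℤ) (μℤ-≢ (ℤP.<⇒≢ (ℤP.<-trans (x<1+x d) 1+d<x))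
    λ d≡x-1 → ℤP.<⇒≢ 1+d<x (trans (cong (_+_ 1ℤ) d≡x-1) (sym (x≡1+[x-1] x))))
  diagonal (no 1+d≮x) = cong (_+ 1ℤ) (begin
    μℤ d x
      ≡⟨ cong (μℤ d) (ℤP.≤-antisym (ℤP.≤-trans (ℤP.i<j⇒suc[i]≤j d<c) c≤x) (ℤP.≮⇒≥ 1+d≮x)) ⟨
    μℤ d (1ℤ + d)
      ≡⟨ cong (λ y → μℤ y (1ℤ + d)) ([1+x]-1≡x d) ⟨
    μℤ ((1ℤ + d) - 1ℤ) (1ℤ + d)
      ≡⟨ μℤ-pred (1ℤ + d) ⟩
    - 1ℤ ∎)

localSums-diagonal : ∀ {x} {D C : Vec ℤ n} → InP (x ∷ C) → D ≤m C → D ≢ C → localSums x x D C ≡ 0ℤ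
localSums-diagonal {D = []}    {[]}    _          _                 D≢C = contradiction refl D≢C
localSums-diagonal {x = x} {d ∷ D} {c ∷ C} (c≤x , C∈) (d≤c , _ , D≤C) D≢C with d ≟ c
... | yes refl = trans (cong (localSum x x d d *_) (localSums-diagonal C∈ D≤C (D≢C ∘ cong (d ∷_))))
                      (ℤP.*-zeroʳ (localSum x x d d))
... | no d≢c   = trans (cong (_* localSums d c D C) (localSum-diagonal (ℤP.≤∧≢⇒< d≤c d≢c) c≤x))
                      (ℤP.*-zeroˡ (localSums d c D C))

μ-formula-sentinel : ∀ {M d c} {D C : Vec ℤ n} → c < M → ∀ E →
  μ-formula (d ∷ D) E when does (E ∈[ d ∷ D , c ∷ C ]?)
    ≡ μ-formula-after M M (d ∷ D) E when does ((M ∷ E) ∈[ M ∷ d ∷ D , M ∷ c ∷ C ]?)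
μ-formula-sentinel {M = M} {d} {c} {D} {C} c<M (e ∷ E) = by-cases ((e ∷ E) ∈[ d ∷ D , c ∷ C ]?)
  where
  M∷E∈? = (M ∷ e ∷ E) ∈[ M ∷ d ∷ D , M ∷ c ∷ C ]?

  by-cases : (E∈? : Dec ((e ∷ E) ∈[ d ∷ D , c ∷ C ])) →
    μ-formula (d ∷ D) (e ∷ E) when does E∈? ≡ μ-formula-after M M (d ∷ D) (e ∷ E) when does M∷E∈?
  by-cases (yes E∈@(_ , _ , e≤c , _)) = sym (begin
    μ-formula-after M M (d ∷ D) (e ∷ E) when does M∷E∈?
      ≡⟨ when-yes _ M∷E∈? (Equivalence.to (∈[]-sentinel c<M) E∈) ⟩
    μ-factor M M d e * μ-formula-after d e D E
      ≡⟨ cong (_* μ-formula-after d e D E) (μ-factor-new-run {d = d} (ℤP.<⇒≢ e<M ∘ sym) e<M) ⟩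
    μℤ d e * μ-formula-after d e D E ∎)
    where
    e<M : e < M
    e<M = ℤP.≤-<-trans e≤c c<M
  by-cases (no E∉) = sym (when-no _ M∷E∈? (E∉ ∘ Equivalence.from (∈[]-sentinel c<M)))

∑-interval≡0 : ∀ {D C : Vec ℤ n} → InP D → InP C → D ≤m C → D ≢ C →
  ∑ (λ E → μ-formula D E when does (E ∈[ D , C ]?)) (box D C) ≡ 0ℤ
∑-interval≡0 {D = []}    {[]}    _  _  _                 D≢C = contradiction refl D≢C
∑-interval≡0 {D = d ∷ D} {c ∷ C} D∈ C∈ D≤C@(d≤c , _) D≢C = begin
  ∑ (λ E → μ-formula (d ∷ D) E when does (E ∈[ d ∷ D , c ∷ C ]?)) (box (d ∷ D) (c ∷ C))
    ≡⟨ ∑-cong (μ-formula-sentinel c<M) (box (d ∷ D) (c ∷ C)) ⟩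
  ∑ (λ E → μ-formula-after M M (d ∷ D) E when does ((M ∷ E) ∈[ M ∷ d ∷ D , M ∷ c ∷ C ]?))
    (box (d ∷ D) (c ∷ C))
    ≡⟨ ∑-interval-after ℤP.≤-refl ℤP.≤-refl (ℤP.<⇒≤ (ℤP.≤-<-trans d≤c c<M) , D∈) (ℤP.<⇒≤ c<M , C∈)
                        D≤C ⟩
  localSums M M (d ∷ D) (c ∷ C)
    ≡⟨ localSums-diagonal (ℤP.<⇒≤ c<M , C∈) D≤C D≢C ⟩
  0ℤ ∎
  where
  M = 1ℤ + c
  c<M : c < M
  c<M = x<1+x c

dist-mono : ∀ {D E C : Vec ℤ n} → D ≤m E → E ≤m C → dist D E ℕ.≤ dist D C
dist-mono {D = []}    {[]}    {[]}    _               _               = ℕ.z≤n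
dist-mono {D = d ∷ D} {e ∷ E} {c ∷ C} (d≤e , _ , D≤E) (e≤c , _ , E≤C) =
  ℕP.+-mono-≤ (∣-∣-mono-≤ (ℤP.i≤j⇒0≤j-i d≤e) (ℤP.+-monoˡ-≤ (- d) e≤c)) (dist-mono D≤E E≤C)

dist-< : ∀ {D E C : Vec ℤ n} → D ≤m E → E ≤m C → E ≢ C → dist D E ℕ.< dist D C
dist-< {D = []}    {[]}    {[]}    _               _               E≢C = contradiction refl E≢C
dist-< {D = d ∷ D} {e ∷ E} {c ∷ C} (d≤e , _ , D≤E) (e≤c , _ , E≤C) E≢C with e ≟ c
... | yes refl = ℕP.+-monoʳ-< ∣ e - d ∣ (dist-< D≤E E≤C (E≢C ∘ cong (e ∷_)))
... | no e≢c   = ℕP.+-mono-<-≤ (∣-∣-mono-< (ℤP.i≤j⇒0≤j-i d≤e) (ℤP.+-monoˡ-< (- d) (ℤP.≤∧≢⇒< e≤c e≢c)))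
                               (dist-mono D≤E E≤C)

mobiusF≡μ-formula : ∀ fuel {D C : Vec ℤ n} → InP D → InP C → D ≤m C → dist D C ℕ.< fuel →
  mobiusF fuel D C ≡ μ-formula D C
mobiusF≡μ-formula (suc fuel) {D} {C} D∈ C∈ D≤C dist<fuel with ≡-dec _≟_ D C
... | yes refl = sym (μ-formula-refl D∈)
... | no D≢C rewrite dec-true (D ≤m? C) D≤C = begin
  - ∑ (mobiusF fuel D) (belowStrict D C)
    ≡⟨ cong -_ (∑-filter below? (mobiusF fuel D) (box D C)) ⟩
  - ∑ (λ E → mobiusF fuel D E when does (below? E)) (box D C)
    ≡⟨ cong -_ (∑-cong (λ E → induction E (below? E)) (box D C)) ⟩
  - ∑ (λ E → μ-formula D E when does (below? E)) (box D C)
    ≡⟨ cong -_ (∑-cong (λ E → when-∧-last (does (InP? E)) (does (D ≤m? E)) (does (E ≤m? C)) _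
                                           (μ-formula D E)) (box D C)) ⟩
  - ∑ (λ E → T E when not (does (≡-dec _≟_ E C))) (box D C)
    ≡⟨ cong -_ (∑-cong (λ E → when-not (T E) (does (≡-dec _≟_ E C))) (box D C)) ⟩
  - ∑ (λ E → T E - (T E when does (≡-dec _≟_ E C))) (box D C)
    ≡⟨ cong -_ (∑-- T _ (box D C)) ⟩
  - (∑ T (box D C) - ∑ (λ E → T E when does (≡-dec _≟_ E C)) (box D C))
    ≡⟨ cong -_ (cong₂ _-_ (∑-interval≡0 D∈ C∈ D≤C D≢C) (∑-box-at T D≤C)) ⟩
  - (0ℤ - T C)
    ≡⟨ cong (λ t → - (0ℤ - t)) (when-yes (μ-formula D C) (C ∈[ D , C ]?) (C∈ , D≤C , ≤m-refl C)) ⟩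
  - (0ℤ - μ-formula D C)
    ≡⟨ -[0-x]≡x (μ-formula D C) ⟩
  μ-formula D C ∎
  where
  T : Vec ℤ _ → ℤ
  T E = μ-formula D E when does (E ∈[ D , C ]?)

  below? : ∀ E → Dec (InP E × D ≤m E × E ≤m C × ¬ E ≡ C)
  below? E = InP? E ×-dec (D ≤m? E) ×-dec (E ≤m? C) ×-dec ¬? (≡-dec _≟_ E C)

  induction : ∀ E (E∈? : Dec (InP E × D ≤m E × E ≤m C × ¬ E ≡ C)) →
    mobiusF fuel D E when does E∈? ≡ μ-formula D E when does E∈?
  induction E (yes (E∈ , D≤E , E≤C , E≢C)) =
    mobiusF≡μ-formula fuel D∈ E∈ D≤E (ℕP.<-≤-trans (dist-< D≤E E≤C E≢C) (ℕ.s≤s⁻¹ dist<fuel))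
  induction E (no _) = refl

  -[0-x]≡x : ∀ x → - (0ℤ - x) ≡ x
  -[0-x]≡x = solve-∀

μ≡μ-formula : ∀ {D C : Vec ℤ n} → InP D → InP C → D ≤m C → μ D C ≡ μ-formula D C
μ≡μ-formula {D = D} {C} D∈ C∈ D≤C = mobiusF≡μ-formula (suc (dist D C)) D∈ C∈ D≤C (ℕP.n<1+n (dist D C))

-- The product formula along the runs of C

NextOK? : ∀ bs e → Dec (NextOK bs e)
NextOK? []            e = yes tt
NextOK? ((N , _) ∷ _) e = N <? e

-- In runWeight x k bs ds, x is the letter of D just read and k the number of letters of the
-- current run of C still to be read.
blockWeight : List (ℤ × ℕ) → List ℤ → ℤ
runWeight   : ℤ → ℕ → List (ℤ × ℕ) → List ℤ → ℤ

blockWeight []             []      = 1ℤ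
blockWeight []             (_ ∷ _) = 0ℤ
blockWeight ((M , k) ∷ bs) ds      = runWeight M k bs ds

runWeight x zero    bs ds       = blockWeight bs ds when does (NextOK? bs x)
runWeight x (suc k) bs []       = 0ℤ
runWeight x (suc k) bs (d ∷ ds) = μℤ d x * runWeight d k bs ds

runs-∷ : ∀ c cs → Σ ℕ λ k → Σ (List (ℤ × ℕ)) λ bs → runs (c ∷ cs) ≡ (c , suc k) ∷ bs
runs-∷ c cs with runs cs
... | []          = 0 , [] , refl
... | (y , k) ∷ r with c ≟ y
...   | yes refl = k , r , refl
...   | no _     = 0 , (y , k) ∷ r , refl

μ-formula-after≡runWeight : ∀ dp cp (D C : Vec ℤ n) {k bs} → runs (cp ∷ toList C) ≡ (cp , suc k) ∷ bs →
  μ-formula-after dp cp D C ≡ runWeight dp k bs (toList D)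
μ-formula-after≡runWeight dp cp []      []      refl = refl
μ-formula-after≡runWeight dp cp (d ∷ D) (c ∷ C) runs≡ with runs-∷ c (toList C)
... | k , bs , runs-c≡ rewrite runs-c≡ = by-cases (cp ≟ c) runs≡
  where
  by-cases : ∀ {k′ bs′} (cp≟c : Dec (cp ≡ c)) →
    (if does cp≟c then (c , suc (suc k)) ∷ bs else (cp , 1) ∷ (c , suc k) ∷ bs) ≡ (cp , suc k′) ∷ bs′ →
    μ-formula-after dp cp (d ∷ D) (c ∷ C) ≡ runWeight dp k′ bs′ (d ∷ toList D)
  by-cases (yes refl) refl =
    cong₂ _*_ (cong (if_then μℤ d dp else (μℤ d cp when does (cp <? dp))) (dec-true (cp ≟ cp) refl))
              (μ-formula-after≡runWeight d cp D C runs-c≡)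
  by-cases (no cp≢c) refl = begin
    (if does (cp ≟ c) then μℤ d dp else (μℤ d c when does (c <? dp))) * μ-formula-after d c D C
      ≡⟨ cong (λ b → (if b then μℤ d dp else (μℤ d c when does (c <? dp))) * μ-formula-after d c D C)
              (dec-false (cp ≟ c) cp≢c) ⟩
    (μℤ d c when does (c <? dp)) * μ-formula-after d c D C
      ≡⟨ when-* (μℤ d c) _ (does (c <? dp)) ⟨
    μℤ d c * μ-formula-after d c D C when does (c <? dp)
      ≡⟨ cong (λ x → μℤ d c * x when does (c <? dp)) (μ-formula-after≡runWeight d c D C runs-c≡) ⟩
    μℤ d c * runWeight d k bs (toList D) when does (c <? dp) ∎

μ-formula≡blockWeight : ∀ (D C : Vec ℤ n) → μ-formula D C ≡ blockWeight (runs (toList C)) (toList D)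
μ-formula≡blockWeight []      []      = refl
μ-formula≡blockWeight (d ∷ D) (c ∷ C) with runs-∷ c (toList C)
... | k , bs , runs≡ rewrite runs≡ = cong (μℤ d c *_) (μ-formula-after≡runWeight d c D C runs≡)

runWeight-chain : ∀ x (X : List ℤ) bs ys → Chain x X →
  runWeight x (length X) bs (X ++ ys)
    ≡ (- 1ℤ) ^ descents x X * (blockWeight bs ys when does (NextOK? bs (endOf x X)))
runWeight-chain x []      bs ys _ = sym (ℤP.*-identityˡ _)
runWeight-chain x (y ∷ X) bs ys (y-step , chain) = begin
  μℤ y x * runWeight y (length X) bs (X ++ ys)
    ≡⟨ cong₂ _*_ (μℤ-chain-step x y y-step) (runWeight-chain y X bs ys chain) ⟩
  (- 1ℤ) ^ step * ((- 1ℤ) ^ descents y X * W)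
    ≡⟨ ℤP.*-assoc ((- 1ℤ) ^ step) ((- 1ℤ) ^ descents y X) W ⟨
  (- 1ℤ) ^ step * (- 1ℤ) ^ descents y X * W
    ≡⟨ cong (_* W) (ℤP.^-distribˡ-+-* (- 1ℤ) step (descents y X)) ⟨
  (- 1ℤ) ^ descents x (y ∷ X) * W ∎
  where
  step = if does (y ≟ x - 1ℤ) then 1 else 0
  W = blockWeight bs ys when does (NextOK? bs (endOf y X))

blockWeight-concat : ∀ bs Xs → AllBlocks bs Xs → blockWeight bs (concat Xs) ≡ (- 1ℤ) ^ Scount bs Xs
blockWeight-concat []             []       _                               = refl
blockWeight-concat ((M , _) ∷ bs) (X ∷ Xs) (refl , chain , next , blocks) = begin
  runWeight M (length X) bs (X ++ concat Xs)
    ≡⟨ runWeight-chain M X bs (concat Xs) chain ⟩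
  (- 1ℤ) ^ descents M X * (blockWeight bs (concat Xs) when does (NextOK? bs (endOf M X)))
    ≡⟨ cong ((- 1ℤ) ^ descents M X *_) (trans (when-yes _ (NextOK? bs (endOf M X)) next)
                                              (blockWeight-concat bs Xs blocks)) ⟩
  (- 1ℤ) ^ descents M X * (- 1ℤ) ^ Scount bs Xs
    ≡⟨ ℤP.^-distribˡ-+-* (- 1ℤ) (descents M X) (Scount bs Xs) ⟨
  (- 1ℤ) ^ Scount ((M , length X) ∷ bs) (X ∷ Xs) ∎

blockWeight≢0 : ∀ bs ds → blockWeight bs ds ≢ 0ℤ →
  Σ (List (List ℤ)) λ Xs → concat Xs ≡ ds × AllBlocks bs Xs
runWeight≢0   : ∀ x k bs ds → runWeight x k bs ds ≢ 0ℤ →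
  Σ (List ℤ) λ X → Σ (List ℤ) λ ys →
    ds ≡ X ++ ys × length X ≡ k × Chain x X × NextOK bs (endOf x X) × blockWeight bs ys ≢ 0ℤ

blockWeight≢0 []             []       _   = [] , refl , tt
blockWeight≢0 []             (_ ∷ _)  w≢0 = contradiction refl w≢0
blockWeight≢0 ((M , k) ∷ bs) ds       w≢0 with runWeight≢0 M k bs ds w≢0
... | X , ys , refl , len , chain , next , w′≢0 with blockWeight≢0 bs ys w′≢0
...   | Xs , refl , blocks = X ∷ Xs , refl , len , chain , next , blocks

runWeight≢0 x zero    bs ds       w≢0 with when≢0 (blockWeight bs ds) (NextOK? bs x) w≢0
... | next , w′≢0 = [] , ds , refl , refl , tt , next , w′≢0
runWeight≢0 x (suc k) bs []       w≢0 = contradiction refl w≢0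
runWeight≢0 x (suc k) bs (d ∷ ds) w≢0 with *≢0 (μℤ d x) (runWeight d k bs ds) w≢0
... | μ≢0 , w′≢0 with runWeight≢0 d k bs ds w′≢0
...   | X , ys , refl , refl , chain , next , w″≢0 =
  d ∷ X , ys , refl , refl , (μℤ≢0 d x μ≢0 , chain) , next , w″≢0

proposition5p6 : ∀ {m : ℕ} (C D : Vec ℤ m) → InP C → InP D → D ≤m C →
    ((Xs : List (List ℤ)) → Decomp C D Xs →
       μ D C ≡ (- 1ℤ) ^ Scount (runs (toList C)) Xs)
    × (¬ (D ∈𝔹 C) → μ D C ≡ 0ℤ)
proposition5p6 C D C∈ D∈ D≤C = on-𝔹 , off-𝔹
  where
  μ≡blockWeight : μ D C ≡ blockWeight (runs (toList C)) (toList D)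
  μ≡blockWeight = trans (μ≡μ-formula D∈ C∈ D≤C) (μ-formula≡blockWeight D C)

  on-𝔹 : (Xs : List (List ℤ)) → Decomp C D Xs → μ D C ≡ (- 1ℤ) ^ Scount (runs (toList C)) Xs
  on-𝔹 Xs (concat≡D , blocks) =
    trans μ≡blockWeight (subst (λ ds → blockWeight (runs (toList C)) ds ≡ (- 1ℤ) ^ Scount (runs (toList C)) Xs)
                               concat≡D (blockWeight-concat (runs (toList C)) Xs blocks))

  off-𝔹 : ¬ (D ∈𝔹 C) → μ D C ≡ 0ℤ
  off-𝔹 D∉𝔹 with blockWeight (runs (toList C)) (toList D) ≟ 0ℤ
  ... | yes w≡0 = trans μ≡blockWeight w≡0
  ... | no w≢0  = contradiction (blockWeight≢0 _ _ w≢0) D∉𝔹
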